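{- A connected graph $G$ on more than three vertices is Cartesian-topfull if and only if it has no cut vertex.
   Context: Graphs are finite, simple and undirected; $d_G$ denotes shortest-path distance. A cut vertex of a connected graph $G$ is a vertex $v$ with $G-v$ disconnected. For an integer $\ell\ge0$, a weak walk of length $\ell$ on $G$ is a function $f:\{0,\dots,\ell\}\to V(G)$ with $f(i)=f(i+1)$ or $f(i)f(i+1)\in E(G)$ for all $0\le i<\ell$; a weak $\ell$-track is a surjective weak walk. For a family $F=\{f_1,\dots,f_p\}$ ($p\ge2$) of such functions, $m_G(F)=\min_{i\ne j}\min_t d_G(f_i(t),f_j(t))$. A family $F=\{f_1,\dots,f_p\}$ of weak walks of length $\ell$ is patient if for each $i\in\{0,\dots,\ell-1\}$ there is $j$ with $f_j(i)f_j(i+1)\in E(G)$ and $f_{j'}(i)=f_{j'}(i+1)$ for all $j'\ne j$; a patient $\ell$-tour is a patient family all of whose members are weak $\ell$-tracks. For a non-trivial connected $G$ that is not a path, the Cartesian $1$-capacity $\mathrm{cap}^\square_1(G)$ is the maximum $c$ such that there is a patient $\ell$-tour $F=\{f_1,\dots,f_c\}$ on $G$ (some $\ell$) with $m_G(F)=1$. A connected graph $G$ on $n$ vertices is Cartesian-topfull if $\mathrm{cap}^\square_1(G)=n-1$. -}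

module Defs where

open import Data.Nat using (ℕ; zero; suc; _≤_; _<_; _∸_)
open import Data.Fin using (Fin; inject₁) renaming (suc to fsuc)
open import Data.Unit using (⊤)
open import Data.Bool using (Bool; true; false)
open import Data.Product using (Σ; ∃; ∃-syntax; _×_; _,_)
open import Data.Sum using (_⊎_)
open import Relation.Binary.PropositionalEquality using (_≡_)
open import Relation.Nullary using (¬_)

record Graph (n : ℕ) : Set where
  field
    adj   : Fin n → Fin n → Bool
    sym   : ∀ u v → adj u v ≡ adj v u
    irrefl : ∀ v → adj v v ≡ false

open Graph public

module _ {n : ℕ} (G : Graph n) where

  Adj : Fin n → Fin n → Set
  Adj u v = adj G u v ≡ true

  data WalkIn (P : Fin n → Set) : Fin n → Fin n → ℕ → Set where
    here : ∀ {u} → P u → WalkIn P u u 0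
    step : ∀ {u w x k} → P u → Adj u w → WalkIn P w x k → WalkIn P u x (suc k)

  Walk : Fin n → Fin n → ℕ → Set
  Walk = WalkIn (λ _ → ⊤)

  Connected : Set
  Connected = ∀ u w → ∃[ k ] Walk u w k

  IsCutVertex : Fin n → Set
  IsCutVertex v = ∃[ u ] ∃[ w ] (¬ u ≡ v × ¬ w ≡ v ×
                    ¬ (∃[ k ] WalkIn (λ x → ¬ x ≡ v) u w k))

  HasCutVertex : Set
  HasCutVertex = ∃[ v ] IsCutVertex v

  IsDist : Fin n → Fin n → ℕ → Set
  IsDist u w k = Walk u w k × (∀ k' → Walk u w k' → k ≤ k')

  WeakWalkFn : ℕ → Set
  WeakWalkFn ℓ = Fin (suc ℓ) → Fin n

  IsWeakWalk : ∀ {ℓ} → WeakWalkFn ℓ → Set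
  IsWeakWalk {ℓ} f = ∀ (i : Fin ℓ) → f (inject₁ i) ≡ f (fsuc i) ⊎ Adj (f (inject₁ i)) (f (fsuc i))

  Surjective : ∀ {ℓ} → WeakWalkFn ℓ → Set
  Surjective f = ∀ v → ∃[ t ] f t ≡ v

  IsWeakTrack : ∀ {ℓ} → WeakWalkFn ℓ → Set
  IsWeakTrack f = IsWeakWalk f × Surjective f

  Family : ℕ → ℕ → Set
  Family p ℓ = Fin p → WeakWalkFn ℓ

  IsPatient : ∀ {p ℓ} → Family p ℓ → Set
  IsPatient {p} {ℓ} F =
    (∀ j → IsWeakWalk (F j)) ×
    (∀ (i : Fin ℓ) → ∃[ j ] (Adj (F j (inject₁ i)) (F j (fsuc i)) ×
        (∀ j' → ¬ j' ≡ j → F j' (inject₁ i) ≡ F j' (fsuc i))))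

  IsPatientTour : ∀ {p ℓ} → Family p ℓ → Set
  IsPatientTour F = IsPatient F × (∀ j → IsWeakTrack (F j))

  MinDistIsOne : ∀ {p ℓ} → Family p ℓ → Set
  MinDistIsOne {p} {ℓ} F =
    (∀ (i j : Fin p) → ¬ i ≡ j → ∀ t k → IsDist (F i t) (F j t) k → 1 ≤ k) ×
    (∃[ i ] ∃[ j ] ∃[ t ] (¬ i ≡ j × IsDist (F i t) (F j t) 1))

  Achieves : ℕ → Set
  Achieves c = ∃[ ℓ ] ∃[ F ] (IsPatientTour {c} {ℓ} F × MinDistIsOne F)

  CapIs : ℕ → Set
  CapIs c = 2 ≤ c × Achieves c × (∀ c' → c < c' → ¬ Achieves c')

  CartesianTopfull : Set
  CartesianTopfull = CapIs (n ∸ 1)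

module Submission where

-- With n − 1 walkers (pebbles) on n vertices, pairwise distance ≥ 1 means the walkers occupy distinct
-- vertices, so exactly one vertex is free and every move slides a walker onto it.  If v were
-- a cut vertex, a walker could leave the component of G − v it is in only by stepping onto v
-- and then onto the free vertex, which at that moment lies in the same component; so no walker
-- visits two components.  Conversely, without cut vertices the free vertex can be routed
-- around any walker to any neighbour of it, so each walker in turn can be walked anywhere
-- (as in the 15-puzzle), and concatenating such runs gives a tour.  More walkers cannot even
-- make a first move.

open import Data.Bool using (true)
open import Data.Bool.Properties using () renaming (_≟_ to _≟ᵇ_)
open import Data.Fin using (Fin; zero; suc; inject₁; punchIn; punchOut; fromℕ<)
open import Data.Fin.Induction using (<-weakInduction-startingFrom)
open import Data.Fin.Permutation using (Permutation′; _⟨$⟩ʳ_; _⟨$⟩ˡ_; inverseʳ; transpose; _∘ₚ_; id)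
import Data.Fin.Permutation.Components as PC
open import Data.Fin.Properties
  using (_≟_; suc-injective; injective⇒≤; punchOut-injective; punchOut-cong; punchIn-punchOut; punchInᵢ≢i; any?; ≤-total)
open import Data.List using (List; _∷_; []; allFin; cartesianProduct)
open import Data.List.Membership.Propositional.Properties using (∈-allFin; ∈-cartesianProduct⁺)
open import Data.List.Relation.Unary.All as All using (All; _∷_; [])
open import Data.Nat using (ℕ; zero; suc; _≤_; _<_; z≤n; s≤s)
open import Data.Nat.Properties using (<⇒≱; 1+n≰n)
open import Data.Product using (Σ-syntax; ∃-syntax; _×_; _,_; proj₂; uncurry)
open import Data.Sum using (_⊎_; inj₁; inj₂)
open import Data.Unit using (tt)
open import Function using (_∘_)
open import Function.Bundles using (_⇔_; mk⇔; Injection)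
open import Function.Definitions using (Injective)
open import Function.Properties.Inverse using (↔⇒↣)
open import Relation.Binary.PropositionalEquality
open import Relation.Nullary using (¬_; Dec; yes; no; contradiction)
open import Relation.Nullary.Decidable using (map′; _×-dec_; decidable-stable; dec-true; dec-false)

open import Defs hiding (sym)

private
  variable
    a b c n ℓ k : ℕ

Misses : (Fin a → Fin b) → Fin b → Set
Misses f h = ∀ j → f j ≢ h

module _ {f : Fin a → Fin (suc b)} {h : Fin (suc b)} (h∉f : Misses f h) where

  punchOut-map : Fin a → Fin b
  punchOut-map j = punchOut (h∉f j ∘ sym)

  punchOut-map-injective : Injective _≡_ _≡_ f → Injective _≡_ _≡_ punchOut-map
  punchOut-map-injective f-inj = f-inj ∘ punchOut-injective (h∉f _ ∘ sym) (h∉f _ ∘ sym)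

  punchOut-map-misses : ∀ {h'} (h≢h' : h ≢ h') → Misses f h' →
                        Misses punchOut-map (punchOut h≢h')
  punchOut-map-misses h≢h' h'∉f j = h'∉f j ∘ punchOut-injective (h∉f j ∘ sym) h≢h'

missing⇒≤ : {f : Fin a → Fin (suc b)} {h : Fin (suc b)} →
            Injective _≡_ _≡_ f → Misses f h → a ≤ b
missing⇒≤ f-inj h∉f = injective⇒≤ (punchOut-map-injective h∉f f-inj)

unique-missing : {f : Fin c → Fin (suc c)} {h h' : Fin (suc c)} →
                 Injective _≡_ _≡_ f → Misses f h → Misses f h' → h ≡ h'
unique-missing {zero} {h = zero} {zero} _ _ _ = refl
unique-missing {suc c} {h = h} {h'} f-inj h∉f h'∉f with h ≟ h'
... | yes h≡h' = h≡h'
... | no h≢h' = contradiction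
  (missing⇒≤ (punchOut-map-injective h∉f f-inj) (punchOut-map-misses h∉f h≢h' h'∉f)) 1+n≰n

module _ (G : Graph n) where

  Reach : Fin n → Fin n → Set
  Reach u w = ∃[ k ] Walk G u w k

  ReachAvoiding : Fin n → Fin n → Fin n → Set
  ReachAvoiding v u w = ∃[ k ] WalkIn G (_≢ v) u w k

  adj-sym : ∀ {u w} → Adj G u w → Adj G w u
  adj-sym {u} {w} e = trans (Graph.sym G w u) e

  adj-irrefl : ∀ {u w} → Adj G u w → u ≢ w
  adj-irrefl {u} e refl with () ← trans (sym (irrefl G u)) e

  walk₀-≡ : ∀ {u w} → Walk G u w 0 → u ≡ w
  walk₀-≡ (here _) = refl

  adj⇒dist1 : ∀ {u w} → Adj G u w → IsDist G u w 1
  adj⇒dist1 e = step tt e (here tt) , λ where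
    zero w → contradiction (walk₀-≡ w) (adj-irrefl e)
    (suc k) _ → s≤s z≤n

  module _ {P : Fin n → Set} where

    walk-head : ∀ {u w} → WalkIn G P u w k → P u
    walk-head (here p) = p
    walk-head (step p _ _) = p

    walk-departs : ∀ {u w} → WalkIn G P u w k → u ≢ w → ∃[ x ] (Adj G u x × P x)
    walk-departs (here _) u≢u = contradiction refl u≢u
    walk-departs (step _ e rest) _ = _ , e , walk-head rest

    walk-snoc : ∀ {u w x} → WalkIn G P u w k → P x → Adj G w x → WalkIn G P u x (suc k)
    walk-snoc (here p) px e = step p e (here px)
    walk-snoc (step p e rest) px e' = step p e (walk-snoc rest px e')

    walk-reverse : ∀ {u w} → WalkIn G P u w k → WalkIn G P w u k
    walk-reverse (here p) = here p
    walk-reverse (step p e rest) = walk-snoc (walk-reverse rest) p (adj-sym e)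

    walk-forget : ∀ {u w} → WalkIn G P u w k → Walk G u w k
    walk-forget (here _) = here tt
    walk-forget (step _ e rest) = step tt e (walk-forget rest)

  reachAvoiding-extend : ∀ {v u w x} → ReachAvoiding v u w → Adj G w x → x ≢ v →
                         ReachAvoiding v u x
  reachAvoiding-extend (k , walk) e x≢v = suc k , walk-snoc walk x≢v e

  reachAvoiding-sym : ∀ {v u w} → ReachAvoiding v u w → ReachAvoiding v w u
  reachAvoiding-sym (k , walk) = k , walk-reverse walk

  last-exit : ∀ {u w} (z : Fin n) → Walk G u w k → z ≢ w →
              ReachAvoiding z u w ⊎ ∃[ x ] (Adj G z x × ReachAvoiding z x w)
  last-exit z (here _) z≢w = inj₁ (0 , here (z≢w ∘ sym))
  last-exit {u = u} z (step {w = x} _ e rest) z≢w with last-exit z rest z≢w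
  ... | inj₂ exit = inj₂ exit
  ... | inj₁ (k , avoiding) with u ≟ z
  ...   | yes refl = inj₂ (x , e , k , avoiding)
  ...   | no u≢z = inj₁ (suc k , step u≢z e avoiding)

_-ᵥ_ : Graph (suc n) → Fin (suc n) → Graph n
G -ᵥ v = record
  { adj    = λ i j → adj G (punchIn v i) (punchIn v j)
  ; sym    = λ i j → Graph.sym G (punchIn v i) (punchIn v j)
  ; irrefl = λ i → irrefl G (punchIn v i)
  }

module _ (G : Graph (suc n)) (v : Fin (suc n)) where

  walkAvoiding⇒walk-ᵥ : ∀ {u w} → WalkIn G (_≢ v) u w k → (v≢u : v ≢ u) (v≢w : v ≢ w) →
                        Walk (G -ᵥ v) (punchOut v≢u) (punchOut v≢w) k
  walkAvoiding⇒walk-ᵥ (here _) v≢u v≢w =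
    subst (λ x → Walk (G -ᵥ v) _ x 0) (punchOut-cong v refl) (here tt)
  walkAvoiding⇒walk-ᵥ (step _ e rest) v≢u v≢w =
    step tt (subst₂ (Adj G) (sym (punchIn-punchOut v≢u)) (sym (punchIn-punchOut v≢x)) e)
            (walkAvoiding⇒walk-ᵥ rest v≢x v≢w)
    where
    v≢x = walk-head G rest ∘ sym

  walk-ᵥ⇒walkAvoiding : ∀ {i j} → Walk (G -ᵥ v) i j k →
                        WalkIn G (_≢ v) (punchIn v i) (punchIn v j) k
  walk-ᵥ⇒walkAvoiding {i = i} (here _) = here (punchInᵢ≢i v i)
  walk-ᵥ⇒walkAvoiding {i = i} (step _ e rest) = step (punchInᵢ≢i v i) e (walk-ᵥ⇒walkAvoiding rest)

-- Recursion on the number of vertices: u reaches w ≠ u iff some neighbour of u reaches w in G - u.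
reach? : (G : Graph n) (u w : Fin n) → Dec (Reach G u w)
reach? {suc n} G u w with u ≟ w
... | yes refl = yes (0 , here tt)
... | no u≢w = map′ enter leave
  (any? λ i → (adj G u (punchIn u i) ≟ᵇ true) ×-dec reach? (G -ᵥ u) i (punchOut u≢w))
  where
  enter : ∃[ i ] (Adj G u (punchIn u i) × Reach (G -ᵥ u) i (punchOut u≢w)) → Reach G u w
  enter (i , e , k , walk) =
    suc k , step tt e (subst (λ x → Walk G _ x k) (punchIn-punchOut u≢w)
                             (walk-forget G (walk-ᵥ⇒walkAvoiding G u walk)))

  leave : Reach G u w → ∃[ i ] (Adj G u (punchIn u i) × Reach (G -ᵥ u) i (punchOut u≢w))
  leave (k , walk) with last-exit G u walk u≢w
  ... | inj₁ (_ , avoiding) = contradiction refl (walk-head G avoiding)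
  ... | inj₂ (x , e , k′ , avoiding) =
    punchOut u≢x , subst (Adj G u) (sym (punchIn-punchOut u≢x)) e ,
    k′ , walkAvoiding⇒walk-ᵥ G u avoiding u≢x u≢w
    where
    u≢x = walk-head G avoiding ∘ sym

reachAvoiding? : (G : Graph (suc n)) (v : Fin (suc n)) {u w : Fin (suc n)} →
                 u ≢ v → w ≢ v → Dec (ReachAvoiding G v u w)
reachAvoiding? G v u≢v w≢v = map′
  (λ (k , walk) → k , subst₂ (λ x y → WalkIn G (_≢ v) x y k)
                              (punchIn-punchOut _) (punchIn-punchOut _) (walk-ᵥ⇒walkAvoiding G v walk))
  (λ (k , walk) → k , walkAvoiding⇒walk-ᵥ G v walk (u≢v ∘ sym) (w≢v ∘ sym))
  (reach? (G -ᵥ v) (punchOut (u≢v ∘ sym)) (punchOut (w≢v ∘ sym)))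

noCutVertex⇒reachAvoiding : (G : Graph (suc n)) → ¬ HasCutVertex G → ∀ {v u w} →
                            u ≢ v → w ≢ v → ReachAvoiding G v u w
noCutVertex⇒reachAvoiding G noCut {v} {u} {w} u≢v w≢v =
  decidable-stable (reachAvoiding? G v u≢v w≢v) λ u↛w → noCut (v , u , w , u≢v , w≢v , u↛w)

module _ (G : Graph n) where

  Move : (σ σ′ : Fin c → Fin n) → Fin c → Set
  Move {c} σ σ′ m = Adj G (σ m) (σ′ m) × (∀ j → j ≢ m → σ j ≡ σ′ j)

  move-reverse : ∀ {σ σ′ : Fin c → Fin n} {m} → Move σ σ′ m → Move σ′ σ m
  move-reverse (e , stay) = adj-sym G e , λ j j≢m → sym (stay j j≢m)

  move-target-missed : ∀ {σ σ′ : Fin c → Fin n} {m} →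
                       Injective _≡_ _≡_ σ′ → Move σ σ′ m → Misses σ (σ′ m)
  move-target-missed {m = m} σ′-inj (e , stay) j with j ≟ m
  ... | yes refl = adj-irrefl G e
  ... | no j≢m = j≢m ∘ σ′-inj ∘ trans (sym (stay j j≢m))

  module _ (F : Family G c ℓ) where

    configuration : Fin (suc ℓ) → Fin c → Fin n
    configuration t j = F j t

    Steps : Set
    Steps = ∀ i → ∃[ m ] Move (configuration (inject₁ i)) (configuration (suc i)) m

    Separated : Set
    Separated = ∀ i j → i ≢ j → ∀ t k → IsDist G (F i t) (F j t) k → 1 ≤ k

    steps⇒weakWalks : Steps → ∀ j → IsWeakWalk G (F j)
    steps⇒weakWalks steps j i with steps i
    ... | m , e , stay with j ≟ m
    ...   | yes refl = inj₂ e
    ...   | no j≢m = inj₁ (stay j j≢m)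

    separated⇒injective : Separated → ∀ t → Injective _≡_ _≡_ (configuration t)
    separated⇒injective separated t {i} {j} e with i ≟ j
    ... | yes i≡j = i≡j
    ... | no i≢j
      with () ← separated i j i≢j t 0 (subst (λ x → Walk G (F i t) x 0) e (here tt) , λ _ _ → z≤n)

    injective⇒separated : (∀ t → Injective _≡_ _≡_ (configuration t)) → Separated
    injective⇒separated inj i j i≢j t zero (walk , _) = contradiction (inj t (walk₀-≡ G walk)) i≢j
    injective⇒separated inj i j i≢j t (suc k) _ = s≤s z≤n

-- A tour of length 0 cannot visit two vertices; otherwise its first move needs a free vertex.
achieves⇒≤ : (G : Graph (suc n)) → 0 < n → Achieves G c → c ≤ n
achieves⇒≤ {c = zero} _ _ _ = z≤n
achieves⇒≤ {c = suc c} G (s≤s _) (zero , F , (_ , tracks) , _)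
  with zero , e₀ ← proj₂ (tracks zero) zero
     | zero , e₁ ← proj₂ (tracks zero) (suc zero)
  with () ← trans (sym e₀) e₁
achieves⇒≤ {c = suc c} G _ (suc ℓ , F , ((_ , steps) , _) , separated , _) =
  missing⇒≤ (inj zero) (move-target-missed G (inj (suc zero)) (proj₂ (steps zero)))
  where
  inj = separated⇒injective G F separated

module Confinement (G : Graph (suc n)) (F : Family G n ℓ) (steps : Steps G F)
                   (inj : ∀ t → Injective _≡_ _≡_ (configuration G F t))
                   (p : Fin n) (v : Fin (suc n)) where

  -- Pebble p stays in the component of r in G - v, except while it sits on v; and then
  -- the free vertex lies in that component, so p can only leave v back into it.
  Confined : Fin (suc n) → Fin (suc ℓ) → Set
  Confined r t = ReachAvoiding G v r (F p t)
               ⊎ (F p t ≡ v × ∃[ h ] (ReachAvoiding G v r h × Misses (configuration G F t) h))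

  confined-step : ∀ r i → Confined r (inject₁ i) → Confined r (suc i)
  confined-step r i with steps i
  ... | m , move@(e , stay) = preserve
    where
    t = inject₁ i
    target-free = move-target-missed G (inj (suc i)) move
    source-free = move-target-missed G (inj t) (move-reverse G move)

    preserve : Confined r t → Confined r (suc i)
    preserve (inj₁ r⇝p) with p ≟ m
    ... | no p≢m = inj₁ (subst (ReachAvoiding G v r) (stay p p≢m) r⇝p)
    ... | yes refl with F p (suc i) ≟ v
    ...   | yes p′≡v = inj₂ (p′≡v , F p t , r⇝p , source-free)
    ...   | no p′≢v = inj₁ (reachAvoiding-extend G r⇝p e p′≢v)
    preserve (inj₂ (p≡v , h , r⇝h , h-free)) with p ≟ m | unique-missing (inj t) h-free target-free
    ... | yes refl | refl = inj₁ r⇝h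
    ... | no p≢m | refl =
      inj₂ (trans (sym (stay p p≢m)) p≡v , F m t ,
            reachAvoiding-extend G r⇝h (adj-sym G e) (p≢m ∘ inj t ∘ trans p≡v ∘ sym) , source-free)

  confined-later : ∀ {s t} → s Data.Fin.≤ t → F p s ≢ v → F p t ≢ v →
                   ReachAvoiding G v (F p s) (F p t)
  confined-later {s} s≤t ps≢v pt≢v
    with <-weakInduction-startingFrom (Confined (F p s)) (inj₁ (0 , here ps≢v))
                                      (confined-step (F p s)) s≤t
  ... | inj₁ s⇝t = s⇝t
  ... | inj₂ (pt≡v , _) = contradiction pt≡v pt≢v

  visited-connected : ∀ {x y} → ∃[ t ] F p t ≡ x → ∃[ t ] F p t ≡ y → x ≢ v → y ≢ v →
                      ReachAvoiding G v x y
  visited-connected (s , refl) (t , refl) x≢v y≢v with ≤-total s t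
  ... | inj₁ s≤t = confined-later s≤t x≢v y≢v
  ... | inj₂ t≤s = reachAvoiding-sym G (confined-later t≤s y≢v x≢v)

achieves⇒noCutVertex : (G : Graph (suc n)) → 0 < n → Achieves G n → ¬ HasCutVertex G
achieves⇒noCutVertex G 0<n (ℓ , F , ((_ , steps) , tracks) , separated , _)
                           (v , u , w , u≢v , w≢v , u↛w) =
  u↛w (visited-connected (proj₂ (tracks p) u) (proj₂ (tracks p) w) u≢v w≢v)
  where
  p = fromℕ< 0<n
  open Confinement G F steps (separated⇒injective G F separated) p v

transpose-zero-suc-same : (q : Fin n) → PC.transpose zero (suc q) (suc q) ≡ zero
transpose-zero-suc-same q rewrite dec-true (q ≟ q) refl = refl

transpose-zero-suc-other : {j q : Fin n} → j ≢ q → PC.transpose zero (suc q) (suc j) ≡ suc j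
transpose-zero-suc-other {j = j} {q} j≢q rewrite dec-false (j ≟ q) j≢q = refl

module Pebbling (G : Graph (suc n)) where

  -- Token zero marks the free vertex and token suc j the position of pebble j.
  Placement : Set
  Placement = Permutation′ (suc n)

  pebble : Placement → Fin n → Fin (suc n)
  pebble π j = π ⟨$⟩ʳ suc j

  hole : Placement → Fin (suc n)
  hole π = π ⟨$⟩ʳ zero

  placement-injective : (π : Placement) → Injective _≡_ _≡_ (π ⟨$⟩ʳ_)
  placement-injective π = Injection.injective (↔⇒↣ π)

  pebble-injective : (π : Placement) → Injective _≡_ _≡_ (pebble π)
  pebble-injective π = suc-injective ∘ placement-injective π

  hole-free : (π : Placement) → Misses (pebble π) (hole π)
  hole-free π j e with () ← placement-injective π e

  occupied : (π : Placement) {y : Fin (suc n)} → y ≢ hole π → ∃[ q ] pebble π q ≡ y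
  occupied π {y} y≢hole with π ⟨$⟩ˡ y in eq
  ... | zero = contradiction (trans (sym (inverseʳ π)) (cong (π ⟨$⟩ʳ_) eq)) y≢hole
  ... | suc q = q , trans (cong (π ⟨$⟩ʳ_) (sym eq)) (inverseʳ π)

  slide : Placement → Fin n → Placement
  slide π q = transpose zero (suc q) ∘ₚ π

  pebble-slide : ∀ π q → pebble (slide π q) q ≡ hole π
  pebble-slide π q = cong (π ⟨$⟩ʳ_) (transpose-zero-suc-same q)

  pebble-slide-other : ∀ π {q j} → j ≢ q → pebble (slide π q) j ≡ pebble π j
  pebble-slide-other π j≢q = cong (π ⟨$⟩ʳ_) (transpose-zero-suc-other j≢q)

  slide-move : ∀ π {q} → Adj G (pebble π q) (hole π) → Move G (pebble π) (pebble (slide π q)) q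
  slide-move π {q} e =
    subst (Adj G _) (sym (pebble-slide π q)) e , λ j j≢q → sym (pebble-slide-other π j≢q)

  data Run (π : Placement) : Placement → Set where
    done : Run π π
    move : ∀ {ρ} q → Adj G (pebble π q) (hole π) → Run (slide π q) ρ → Run π ρ

  length : ∀ {π ρ} → Run π ρ → ℕ
  length done = 0
  length (move _ _ r) = suc (length r)

  placementAt : ∀ {π ρ} (r : Run π ρ) → Fin (suc (length r)) → Placement
  placementAt {π} _ zero = π
  placementAt (move _ _ r) (suc t) = placementAt r t

  run-moves : ∀ {π ρ} (r : Run π ρ) (i : Fin (length r)) →
              ∃[ q ] Move G (pebble (placementAt r (inject₁ i))) (pebble (placementAt r (suc i))) q
  run-moves {π} (move q e _) zero = q , slide-move π e
  run-moves (move _ _ r) (suc i) = run-moves r i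

  _++_ : ∀ {π σ ρ} → Run π σ → Run σ ρ → Run π ρ
  done ++ r′ = r′
  move q e r ++ r′ = move q e (r ++ r′)

  Visits : ∀ {π ρ} → Run π ρ → Fin n → Fin (suc n) → Set
  Visits r p x = ∃[ t ] pebble (placementAt r t) p ≡ x

  visits-++ʳ : ∀ {π σ ρ} (r : Run π σ) {r′ : Run σ ρ} {p x} →
               Visits r′ p x → Visits (r ++ r′) p x
  visits-++ʳ done visit = visit
  visits-++ʳ (move _ _ r) visit with t , e ← visits-++ʳ r visit = suc t , e

  moveHole : ∀ π p {y} → WalkIn G (_≢ pebble π p) (hole π) y k →
             ∃[ ρ ] (Run π ρ × hole ρ ≡ y × pebble ρ p ≡ pebble π p)
  moveHole π p (here _) = π , done , refl , refl
  moveHole π p {y} (step _ e rest) with occupied π (adj-irrefl G e ∘ sym)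
  ... | q , refl =
    extend (moveHole (slide π q) p (subst (λ z → WalkIn G (_≢ z) (pebble π q) y _) (sym p-stays) rest))
    where
    p-stays : pebble (slide π q) p ≡ pebble π p
    p-stays = pebble-slide-other π (walk-head G rest ∘ cong (pebble π) ∘ sym)

    extend : ∃[ ρ ] (Run (slide π q) ρ × hole ρ ≡ y × pebble ρ p ≡ pebble (slide π q) p) →
             ∃[ ρ ] (Run π ρ × hole ρ ≡ y × pebble ρ p ≡ pebble π p)
    extend (ρ , r , ρ-hole , ρ-p) = ρ , move q (adj-sym G e) r , ρ-hole , trans ρ-p p-stays

  runFamily : ∀ {π ρ} (r : Run π ρ) → Family G n (length r)
  runFamily r j t = pebble (placementAt r t) j

  run-achieves : ∀ {π ρ} (r : Run π ρ) → (∀ p x → Visits r p x) →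
                 ∃[ i ] ∃[ q ] Adj G (pebble π i) (pebble π q) → Achieves G n
  run-achieves {π} r visits (i , q , e) =
    length r , F , ((weakWalks , steps) , λ j → weakWalks j , visits j) ,
    injective⇒separated G F (pebble-injective ∘ placementAt r) ,
    i , q , zero , adj-irrefl G e ∘ cong (pebble π) , adj⇒dist1 G e
    where
    F = runFamily r
    steps = run-moves r
    weakWalks = steps⇒weakWalks G F steps

module Touring (G : Graph (suc n)) (noCut : ¬ HasCutVertex G) (connected : Connected G) where

  open Pebbling G

  -- The free vertex is routed to y along a walk avoiding p, which exists as p's vertex is no cut vertex.
  movePebbleStep : ∀ π p {y} → Adj G (pebble π p) y → ∃[ ρ ] (Run π ρ × pebble ρ p ≡ y)
  movePebbleStep π p {y} e
    with ρ , r , refl , ρ-p ← moveHole π p (proj₂ (noCutVertex⇒reachAvoiding G noCut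
                                  (hole-free π p ∘ sym) (adj-irrefl G e ∘ sym)))
    = slide ρ p , r ++ move p (subst (λ z → Adj G z (hole ρ)) (sym ρ-p) e) done , pebble-slide ρ p

  movePebbleAlong : ∀ π p {y} → Walk G (pebble π p) y k → ∃[ ρ ] (Run π ρ × pebble ρ p ≡ y)
  movePebbleAlong π p (here _) = π , done , refl
  movePebbleAlong π p (step _ e rest)
    with ρ , r , refl ← movePebbleStep π p e
    with ρ′ , r′ , ρ′-p ← movePebbleAlong ρ p rest
    = ρ′ , r ++ r′ , ρ′-p

  visitAll : ∀ π (L : List (Fin n × Fin (suc n))) →
             ∃[ ρ ] Σ[ r ∈ Run π ρ ] All (uncurry (Visits r)) L
  visitAll π [] = π , done , []
  visitAll π ((p , x) ∷ L)
    with ρ , r , refl ← movePebbleAlong π p (proj₂ (connected (pebble π p) x))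
    with ρ′ , r′ , visits ← visitAll ρ L
    = ρ′ , r ++ r′ , visits-++ʳ r (zero , refl) ∷ All.map (visits-++ʳ r) visits

  tour : ∀ π → ∃[ ρ ] Σ[ r ∈ Run π ρ ] ∀ p x → Visits r p x
  tour π with ρ , r , visits ← visitAll π (cartesianProduct (allFin n) (allFin (suc n)))
    = ρ , r , λ p x → All.lookup visits (∈-cartesianProduct⁺ (∈-allFin p) (∈-allFin x))

  pebble-neighbour : ∀ π {i j} → i ≢ j → ∃[ q ] Adj G (pebble π i) (pebble π q)
  pebble-neighbour π {i} {j} i≢j
    with x , e , x≢hole ← walk-departs G
           (proj₂ (noCutVertex⇒reachAvoiding G noCut (hole-free π i) (hole-free π j)))
           (i≢j ∘ pebble-injective π)
    with q , refl ← occupied π x≢hole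
    = q , e

noCutVertex⇒achieves : (G : Graph (suc (suc (suc n)))) → ¬ HasCutVertex G → Connected G →
                       Achieves G (suc (suc n))
noCutVertex⇒achieves G noCut connected =
  let _ , r , visits = tour id
  in run-achieves r visits (zero , pebble-neighbour id {zero} {suc zero} λ ())
  where
  open Pebbling G
  open Touring G noCut connected

theorem3p29 : ∀ (n : ℕ) (G : Graph n) → 3 < n → Connected G →
                CartesianTopfull G ⇔ (¬ HasCutVertex G)
theorem3p29 _ G (s≤s (s≤s (s≤s (s≤s _)))) connected = mk⇔
  (λ (_ , achieves , _) → achieves⇒noCutVertex G (s≤s z≤n) achieves)
  (λ noCut → s≤s (s≤s z≤n) , noCutVertex⇒achieves G noCut connected ,
             λ _ n<c achieves → <⇒≱ n<c (achieves⇒≤ G (s≤s z≤n) achieves))
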